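{- Let $\mathcal{E}$ be a multiset of integral Weierstrass models $y^2=x^3+Ax+B$ ($A,B\in\mathbb{Z}$, $4A^3+27B^2\ne0$), and assume that $N^{\mathrm{tw}}_{\mathcal{E}}(X)$ is finite for every $X>0$. Then for every $X>0$, \[ N^{\mathrm{tw}}_{\mathcal{E}}(X) = \sum_{n\ge1}\sum_{e\mid n}\mu(n/e)\, M_{\mathcal{E}}(e^6X;n), \] where $\mu$ is the Möbius function.
   Context: For a model $E: y^2=x^3+Ax+B$ with $A,B\in\mathbb{Z}$, write $H(E)=\max(|4A^3|,|27B^2|)$, let the twist minimality defect $\mathrm{tmd}(E)$ be the largest positive integer $e$ with $e^2\mid A$ and $e^3\mid B$, and let the twist height be $\mathrm{twht}(E)=H(E)/\mathrm{tmd}(E)^6$. For a multiset $\mathcal{E}$ of such models define $N^{\mathrm{tw}}_{\mathcal{E}}(X)=\#\{E\in\mathcal{E}:\mathrm{twht}(E)\le X\}$ and, for $e\in\mathbb{Z}_{>0}$, $M_{\mathcal{E}}(X;e)=\#\{E\in\mathcal{E}: H(E)\le X,\ e\mid \mathrm{tmd}(E)\}$ (multisets counted with multiplicity).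
   Formalization: The height bound X ranges over the positive rationals. -}

module Defs where

open import Data.Bool using (Bool; true; false; if_then_else_; _∧_)
open import Data.Nat as ℕ using (ℕ; zero; suc; _⊔_)
open import Data.Nat.Divisibility using (_∣_; _∣?_)
open import Data.Nat.DivMod using (_/_)
open import Data.Nat.Primality using (prime?)
open import Data.Integer as ℤ using (ℤ; +_; -[1+_]; ∣_∣)
open import Data.Rational as ℚ using (ℚ)
open import Data.List using (List; []; _∷_; map; upTo; filterᵇ; length; foldr)
open import Data.Nat.ListAction using (sum)
open import Data.Bool.ListAction using (any)
open import Data.List.Membership.Propositional using (_∈_)
open import Data.List.Relation.Unary.Unique.Propositional using (Unique)
open import Data.Product using (Σ; ∃; _×_)
open import Relation.Nullary using (¬_; does)
open import Relation.Binary.PropositionalEquality using (_≡_; _≢_)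

natℚ : ℕ → ℚ
natℚ n = (ℤ.+ n) ℚ./ 1

-- An integral Weierstrass model y^2 = x^3 + A x + B is the pair (A , B).
Model : Set
Model = ℤ × ℤ

open Data.Product using (_,_)

disc : Model → ℤ
disc (A , B) = (ℤ.+ 4) ℤ.* (A ℤ.^ 3) ℤ.+ (ℤ.+ 27) ℤ.* (B ℤ.^ 2)

H : Model → ℕ
H (A , B) = ∣ (ℤ.+ 4) ℤ.* (A ℤ.^ 3) ∣ ⊔ ∣ (ℤ.+ 27) ℤ.* (B ℤ.^ 2) ∣

IsTmd : Model → ℕ → Set
IsTmd (A , B) e =
  (0 ℕ.< e) × ((e ℕ.^ 2) ∣ ∣ A ∣) × ((e ℕ.^ 3) ∣ ∣ B ∣) ×
  (∀ e′ → 0 ℕ.< e′ → (e′ ℕ.^ 2) ∣ ∣ A ∣ → (e′ ℕ.^ 3) ∣ ∣ B ∣ → e′ ℕ.≤ e)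

-- twht(E) ≤ X, where twht(E) = H(E) / tmd(E)^6 (cleared denominator)
TwhtLe : ℚ → Model → Set
TwhtLe X E = ∃ λ d → IsTmd E d × (natℚ (H E) ℚ.≤ natℚ (d ℕ.^ 6) ℚ.* X)

-- condition counted by M(Y; n):  H(E) ≤ Y and n ∣ tmd(E)
MCond : ℚ → ℕ → Model → Set
MCond Y n E = (natℚ (H E) ℚ.≤ Y) × (∃ λ d → IsTmd E d × n ∣ d)

-- A multiset of models is given by its multiplicity function.
-- CountIs mult P N : the number of elements (with multiplicity) of the
-- multiset satisfying P is finite and equal to N.
CountIs : (Model → ℕ) → (Model → Set) → ℕ → Set
CountIs mult P N =
  Σ (List Model) λ L → Unique L ×
    (∀ E → (E ∈ L → (mult E ≢ 0 × P E)) × ((mult E ≢ 0 × P E) → E ∈ L)) ×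
    (sum (map mult L) ≡ N)

-- Möbius function (μ 0 is irrelevant)
squareFreeᵇ : ℕ → Bool
squareFreeᵇ n = Data.Bool.not (any (λ i → does (((suc (suc i)) ℕ.* (suc (suc i))) ∣? n)) (upTo n))

ω : ℕ → ℕ
ω n = length (filterᵇ (λ p → does (prime? p) ∧ does (p ∣? n)) (upTo (suc n)))

μ : ℕ → ℤ
μ n = if squareFreeᵇ n then (-[1+ 0 ]) ℤ.^ (ω n) else ℤ.+ 0

sumℤ : List ℤ → ℤ
sumℤ = foldr ℤ._+_ (ℤ.+ 0)

divisorSum : (ℕ → ℕ) → ℕ → ℤ
divisorSum M n = sumℤ (map (λ i → if does (suc i ∣? n)
                                  then μ (n / suc i) ℤ.* ℤ.+ (M (suc i))
                                  else ℤ.+ 0) (upTo n))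

sumTo : (ℕ → ℤ) → ℕ → ℤ
sumTo f K = sumℤ (map (λ i → f (suc i)) (upTo K))

-- For every model E counted at twist height X, the count itself supplies the
-- twist minimality defect t_E, and M(e⁶X; n) counts the E with H(E) ≤ e⁶X and
-- n ∣ t_E.  Exchanging sums, the right-hand side becomes
--   Σ_E mult(E) · Σ_{n ∣ t_E} Σ_{e ∣ n} μ(n/e) [H(E) ≤ e⁶X],
-- and Möbius inversion collapses the inner double sum to [H(E) ≤ t_E⁶X] = 1.
-- The sum over n may stop at K = Σ_E t_E, beyond which every M vanishes.
-- Möbius inversion rests on Σ_{d ∣ n} μ(d) = [n = 1], which follows by
-- splitting the divisors of n = pk according to whether the prime p divides them.

module Submission where

open import Defs
open import Data.Bool using (Bool; true; false; not; _∧_; if_then_else_; T)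
open import Data.Bool.Properties using (not-injective; T-≡)
open import Data.Nat as ℕ using (ℕ; zero; suc; _≤_; _<_; _^_; z≤n; s≤s; NonZero)
import Data.Nat.Properties as ℕ
open import Data.Nat.Primality using (Prime; prime?; ¬prime[1]; prime⇒irreducible; prime⇒nonZero; euclidsLemma)
open import Data.Nat.Primality.Factorisation using (factorise)
open import Data.Nat.Coprimality as Coprime using (Coprime; coprime-divisor)
open import Data.Nat.Divisibility
  using (_∣_; _∣?_; ∣⇒≤; ∣-refl; ∣-trans; m∣m*n; n∣m*n; *-monoʳ-∣; *-pres-∣; *-cancelˡ-∣; ∣m+n∣m⇒∣n)
open import Data.Nat.DivMod using (_/_; m/n*n≡m; m*n/n≡m; n/n≡1)
open import Data.Integer as ℤ using (ℤ; +_)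
open import Data.Rational as ℚ using (ℚ; 0ℚ)
import Data.Rational.Properties as ℚ
import Data.Integer.Properties as ℤ
open import Algebra.Properties.CommutativeSemigroup ℤ.+-commutativeSemigroup using (interchange)
open import Algebra.Properties.CommutativeSemigroup ℤ.*-commutativeSemigroup using (x∙yz≈y∙xz; x∙yz≈z∙xy)
open import Data.List using (List; []; _∷_; _++_; map; upTo; filter; filterᵇ; length)
open import Data.Nat.ListAction using (sum)
import Data.List.Properties as List
open import Data.List.Membership.Propositional using (_∈_; lose)
open import Data.List.Membership.Propositional.Properties using (∈-upTo⁺; ∈-upTo⁻; ∈-filter⁺; ∈-filter⁻)
open import Data.List.Relation.Unary.Any using (here; there; satisfied)
open import Data.List.Relation.Unary.Any.Properties using (any⁺; any⁻)
open import Data.List.Relation.Unary.All as All using (_∷_)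
open import Data.List.Relation.Unary.Unique.Propositional using (Unique)
import Data.List.Relation.Unary.Unique.Propositional.Properties as Unique
import Data.List.Membership.DecPropositional as DecMembership
open import Data.Product.Properties using (≡-dec)
open import Data.Sum using (inj₁; inj₂; [_,_]′)
open import Function.Base using (_∘_)
open import Function.Bundles using (Equivalence)
open import Data.Product using (Σ; ∃; _×_; _,_; proj₁; proj₂)
open import Data.Empty using (⊥-elim)
open import Relation.Nullary using (¬_; Dec; yes; no; does; contradiction)
open import Relation.Nullary.Decidable using (dec-true; dec-false; _×-dec_)
open import Relation.Unary using (Decidable)
open import Relation.Binary.PropositionalEquality
  using (_≡_; _≢_; refl; sym; trans; cong; cong₂; subst; module ≡-Reasoning)

module FiniteSums where
  open import Data.Integer using (_+_; _*_; -_)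

  private variable
    A B : Set

  ∑ : List A → (A → ℤ) → ℤ
  ∑ xs f = sumℤ (map f xs)

  syntax ∑ xs (λ x → e) = ∑[ x ∈ xs ] e

  ∑< : ℕ → (ℕ → ℤ) → ℤ
  ∑< n f = ∑ (upTo n) f

  syntax ∑< n (λ i → e) = ∑[ i < n ] e

  ∑-++ : ∀ xs ys (f : A → ℤ) → ∑ (xs ++ ys) f ≡ ∑ xs f + ∑ ys f
  ∑-++ []       ys f = sym (ℤ.+-identityˡ _)
  ∑-++ (x ∷ xs) ys f = trans (cong (_+_ (f x)) (∑-++ xs ys f)) (sym (ℤ.+-assoc (f x) _ _))

  ∑-distrib-+ : ∀ xs (f g : A → ℤ) → ∑[ x ∈ xs ] (f x + g x) ≡ ∑ xs f + ∑ xs g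
  ∑-distrib-+ []       f g = refl
  ∑-distrib-+ (x ∷ xs) f g rewrite ∑-distrib-+ xs f g = interchange (f x) (g x) (∑ xs f) (∑ xs g)

  *-distribˡ-∑ : ∀ c xs (f : A → ℤ) → c * ∑ xs f ≡ ∑[ x ∈ xs ] (c * f x)
  *-distribˡ-∑ c []       f = ℤ.*-zeroʳ c
  *-distribˡ-∑ c (x ∷ xs) f rewrite sym (*-distribˡ-∑ c xs f) = ℤ.*-distribˡ-+ c (f x) _

  neg-distrib-∑ : ∀ xs (f : A → ℤ) → - ∑ xs f ≡ ∑[ x ∈ xs ] (- f x)
  neg-distrib-∑ []       f = refl
  neg-distrib-∑ (x ∷ xs) f rewrite sym (neg-distrib-∑ xs f) = ℤ.neg-distrib-+ (f x) _

  ∑-cong : ∀ xs {f g : A → ℤ} → (∀ x → x ∈ xs → f x ≡ g x) → ∑ xs f ≡ ∑ xs g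
  ∑-cong []       f≗g = refl
  ∑-cong (x ∷ xs) f≗g = cong₂ _+_ (f≗g x (here refl)) (∑-cong xs (λ y y∈xs → f≗g y (there y∈xs)))

  ∑-zero : ∀ xs {f : A → ℤ} → (∀ x → x ∈ xs → f x ≡ + 0) → ∑ xs f ≡ + 0
  ∑-zero []       f≗0 = refl
  ∑-zero (x ∷ xs) f≗0 rewrite f≗0 x (here refl) =
    trans (ℤ.+-identityˡ _) (∑-zero xs (λ y y∈xs → f≗0 y (there y∈xs)))

  ∑-comm : ∀ xs ys (f : A → B → ℤ) →
    ∑[ x ∈ xs ] ∑[ y ∈ ys ] f x y ≡ ∑[ y ∈ ys ] ∑[ x ∈ xs ] f x y
  ∑-comm []       ys f = sym (∑-zero ys (λ _ _ → refl))
  ∑-comm (x ∷ xs) ys f rewrite ∑-comm xs ys f = sym (∑-distrib-+ ys (f x) (λ y → ∑[ x ∈ xs ] f x y))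

  ∑<-suc : ∀ n f → ∑< (suc n) f ≡ ∑< n f + f n
  ∑<-suc n f = begin
    ∑ (upTo (suc n)) f         ≡⟨ cong (λ xs → ∑ xs f) (sym (List.upTo-∷ʳ n)) ⟩
    ∑ (upTo n ++ n ∷ []) f     ≡⟨ ∑-++ (upTo n) (n ∷ []) f ⟩
    ∑< n f + (f n + + 0)       ≡⟨ cong (_+_ (∑< n f)) (ℤ.+-identityʳ (f n)) ⟩
    ∑< n f + f n               ∎
    where open ≡-Reasoning

  ∑<-cong : ∀ n {f g} → (∀ i → i < n → f i ≡ g i) → ∑< n f ≡ ∑< n g
  ∑<-cong n f≗g = ∑-cong (upTo n) (λ i i∈ → f≗g i (∈-upTo⁻ i∈))

  ∑<-zero : ∀ n {f} → (∀ i → i < n → f i ≡ + 0) → ∑< n f ≡ + 0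
  ∑<-zero n f≗0 = ∑-zero (upTo n) (λ i i∈ → f≗0 i (∈-upTo⁻ i∈))

  ∑<-+ : ∀ m n f → ∑< (m ℕ.+ n) f ≡ ∑< m f + ∑[ j < n ] f (m ℕ.+ j)
  ∑<-+ m zero    f rewrite ℕ.+-identityʳ m = sym (ℤ.+-identityʳ _)
  ∑<-+ m (suc n) f = begin
    ∑< (m ℕ.+ suc n) f
      ≡⟨ cong (λ k → ∑< k f) (ℕ.+-suc m n) ⟩
    ∑< (suc (m ℕ.+ n)) f
      ≡⟨ ∑<-suc (m ℕ.+ n) f ⟩
    ∑< (m ℕ.+ n) f + f (m ℕ.+ n)
      ≡⟨ cong (_+ f (m ℕ.+ n)) (∑<-+ m n f) ⟩
    (∑< m f + ∑[ j < n ] f (m ℕ.+ j)) + f (m ℕ.+ n)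
      ≡⟨ ℤ.+-assoc (∑< m f) _ _ ⟩
    ∑< m f + (∑[ j < n ] f (m ℕ.+ j) + f (m ℕ.+ n))
      ≡⟨ cong (_+_ (∑< m f)) (sym (∑<-suc n (λ j → f (m ℕ.+ j)))) ⟩
    ∑< m f + ∑[ j < suc n ] f (m ℕ.+ j) ∎
    where open ≡-Reasoning

  ∑<-extend : ∀ {m n} f → m ≤ n → (∀ i → m ≤ i → i < n → f i ≡ + 0) → ∑< n f ≡ ∑< m f
  ∑<-extend {m} {n} f m≤n tail≗0 = begin
    ∑< n f                                  ≡⟨ cong (λ k → ∑< k f) (sym (ℕ.m+[n∸m]≡n m≤n)) ⟩
    ∑< (m ℕ.+ (n ℕ.∸ m)) f                  ≡⟨ ∑<-+ m (n ℕ.∸ m) f ⟩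
    ∑< m f + ∑[ j < n ℕ.∸ m ] f (m ℕ.+ j)   ≡⟨ cong (_+_ (∑< m f)) (∑<-zero (n ℕ.∸ m) tail) ⟩
    ∑< m f + + 0                            ≡⟨ ℤ.+-identityʳ _ ⟩
    ∑< m f                                  ∎
    where
    open ≡-Reasoning
    tail : ∀ j → j < n ℕ.∸ m → f (m ℕ.+ j) ≡ + 0
    tail j j<n∸m = tail≗0 (m ℕ.+ j) (ℕ.m≤m+n m j)
      (ℕ.<-≤-trans (ℕ.+-monoʳ-< m j<n∸m) (ℕ.≤-reflexive (ℕ.m+[n∸m]≡n m≤n)))

  ∑<-single : ∀ {k n} f → k < n → (∀ i → i < n → i ≢ k → f i ≡ + 0) → ∑< n f ≡ f k
  ∑<-single {k} {n} f k<n others≗0 = begin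
    ∑< n f
      ≡⟨ ∑<-extend f k<n (λ i k<i i<n → others≗0 i i<n (ℕ.>⇒≢ k<i)) ⟩
    ∑< (suc k) f
      ≡⟨ ∑<-suc k f ⟩
    ∑< k f + f k
      ≡⟨ cong (_+ f k) (∑<-zero k (λ i i<k → others≗0 i (ℕ.<-trans i<k k<n) (ℕ.<⇒≢ i<k))) ⟩
    + 0 + f k
      ≡⟨ ℤ.+-identityˡ (f k) ⟩
    f k ∎
    where open ≡-Reasoning

  𝟙 : Bool → ℤ
  𝟙 true  = + 1
  𝟙 false = + 0

  𝟙-yes : ∀ {P : Set} (P? : Dec P) → P → 𝟙 (does P?) ≡ + 1
  𝟙-yes P? p rewrite dec-true P? p = refl

  𝟙-no : ∀ {P : Set} (P? : Dec P) → ¬ P → 𝟙 (does P?) ≡ + 0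
  𝟙-no P? ¬p rewrite dec-false P? ¬p = refl

  𝟙-∧ : ∀ a b → 𝟙 (a ∧ b) ≡ 𝟙 a * 𝟙 b
  𝟙-∧ true  b = sym (ℤ.*-identityˡ (𝟙 b))
  𝟙-∧ false b = sym (ℤ.*-zeroˡ (𝟙 b))

  if-then-0 : ∀ b x → (if b then x else + 0) ≡ 𝟙 b * x
  if-then-0 true  x = sym (ℤ.*-identityˡ x)
  if-then-0 false x = refl

  +-length-filterᵇ : ∀ (f : A → Bool) xs → + length (filterᵇ f xs) ≡ ∑[ x ∈ xs ] 𝟙 (f x)
  +-length-filterᵇ f []       = refl
  +-length-filterᵇ f (x ∷ xs) with f x
  ... | true  = cong (_+_ (+ 1)) (+-length-filterᵇ f xs)
  ... | false = trans (+-length-filterᵇ f xs) (sym (ℤ.+-identityˡ _))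

  +-sum : ∀ (w : A → ℕ) xs → + sum (map w xs) ≡ ∑[ x ∈ xs ] (+ w x)
  +-sum w []       = refl
  +-sum w (x ∷ xs) = trans (ℤ.pos-+ (w x) _) (cong (_+_ (+ w x)) (+-sum w xs))

  +-sum-filter : ∀ (w : A → ℕ) {P : A → Set} (P? : Decidable P) xs →
    + sum (map w (filter P? xs)) ≡ ∑[ x ∈ xs ] (+ w x * 𝟙 (does (P? x)))
  +-sum-filter w P? []       = refl
  +-sum-filter w P? (x ∷ xs) with does (P? x)
  ... | true  = trans (ℤ.pos-+ (w x) _) (cong₂ _+_ (sym (ℤ.*-identityʳ (+ w x))) (+-sum-filter w P? xs))
  ... | false = trans (+-sum-filter w P? xs) (sym (trans (cong (_+ _) (ℤ.*-zeroʳ (+ w x))) (ℤ.+-identityˡ _)))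

module DivisorSums where
  open import Data.Integer using (_+_; _*_; -_)
  open FiniteSums

  private variable
    A : Set

  [_∣_] : ℕ → ℕ → ℤ
  [ d ∣ n ] = 𝟙 (does (d ∣? n))

  [∣]-yes : ∀ {d n} → d ∣ n → [ d ∣ n ] ≡ + 1
  [∣]-yes = 𝟙-yes (_ ∣? _)

  [∣]-no : ∀ {d n} → ¬ d ∣ n → [ d ∣ n ] ≡ + 0
  [∣]-no = 𝟙-no (_ ∣? _)

  [_∤_] : ℕ → ℕ → ℤ
  [ d ∤ n ] = 𝟙 (not (does (d ∣? n)))

  [∤]-yes : ∀ {d n} → ¬ d ∣ n → [ d ∤ n ] ≡ + 1
  [∤]-yes {d} {n} d∤n = cong (𝟙 ∘ not) (dec-false (d ∣? n) d∤n)

  [∤]-no : ∀ {d n} → d ∣ n → [ d ∤ n ] ≡ + 0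
  [∤]-no {d} {n} d∣n = cong (𝟙 ∘ not) (dec-true (d ∣? n) d∣n)

  ∑∣ : ℕ → (ℕ → ℤ) → ℤ
  ∑∣ n f = ∑[ i < n ] ([ suc i ∣ n ] * f (suc i))

  syntax ∑∣ n (λ d → e) = ∑[ d ∣ n ] e

  ∑∣-cong : ∀ n {f g} → (∀ d → f (suc d) ≡ g (suc d)) → ∑∣ n f ≡ ∑∣ n g
  ∑∣-cong n f≗g = ∑<-cong n (λ i _ → cong ([ suc i ∣ n ] *_) (f≗g i))

  ∑∣-zero : ∀ n {f} → (∀ d → f (suc d) ≡ + 0) → ∑∣ n f ≡ + 0
  ∑∣-zero n f≗0 = ∑<-zero n (λ i _ → trans (cong ([ suc i ∣ n ] *_) (f≗0 i)) (ℤ.*-zeroʳ [ suc i ∣ n ]))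

  ∑∣-distrib-+ : ∀ n f g → ∑[ d ∣ n ] (f d + g d) ≡ ∑∣ n f + ∑∣ n g
  ∑∣-distrib-+ n f g = trans
    (∑<-cong n (λ i _ → ℤ.*-distribˡ-+ [ suc i ∣ n ] (f (suc i)) (g (suc i))))
    (∑-distrib-+ (upTo n) _ _)

  *-distribˡ-∑∣ : ∀ c n f → c * ∑∣ n f ≡ ∑[ d ∣ n ] (c * f d)
  *-distribˡ-∑∣ c n f = trans (*-distribˡ-∑ c (upTo n) _)
    (∑<-cong n (λ i _ → x∙yz≈y∙xz c [ suc i ∣ n ] (f (suc i))))

  neg-distrib-∑∣ : ∀ n f → - ∑∣ n f ≡ ∑[ d ∣ n ] (- f d)
  neg-distrib-∑∣ n f = trans (neg-distrib-∑ (upTo n) _)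
    (∑<-cong n (λ i _ → ℤ.neg-distribʳ-* [ suc i ∣ n ] (f (suc i))))

  [∣]-*-cancelˡ : ∀ c a b → [ suc c ℕ.* a ∣ suc c ℕ.* b ] ≡ [ a ∣ b ]
  [∣]-*-cancelˡ c a b with a ∣? b
  ... | yes a∣b = [∣]-yes (*-monoʳ-∣ (suc c) a∣b)
  ... | no  a∤b = [∣]-no (λ ca∣cb → a∤b (*-cancelˡ-∣ (suc c) ca∣cb))

  ∑∣-range : ∀ {n K} f → 0 < n → n ≤ K → ∑[ i < K ] ([ suc i ∣ n ] * f (suc i)) ≡ ∑∣ n f
  ∑∣-range {n} f 0<n n≤K = ∑<-extend _ n≤K beyond
    where
    instance _ = ℕ.>-nonZero 0<n
    beyond : ∀ i → n ≤ i → _ → [ suc i ∣ n ] * f (suc i) ≡ + 0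
    beyond i n≤i _ rewrite [∣]-no {suc i} {n} (λ i+1∣n → ℕ.<⇒≱ (s≤s n≤i) (∣⇒≤ i+1∣n)) = refl

  ∑<-multiples : ∀ d q (h : ℕ → ℤ) →
    ∑[ i < suc d ℕ.* q ] ([ suc d ∣ suc i ] * h (suc i)) ≡ ∑[ m < q ] h (suc d ℕ.* suc m)
  ∑<-multiples d zero    h rewrite ℕ.*-zeroʳ d = refl
  ∑<-multiples d (suc q) h = begin
    ∑< (D ℕ.* suc q) F
      ≡⟨ cong (λ k → ∑< k F) (ℕ.*-suc D q) ⟩
    ∑< (D ℕ.+ D ℕ.* q) F
      ≡⟨ cong (λ k → ∑< k F) (ℕ.+-comm D (D ℕ.* q)) ⟩
    ∑< (D ℕ.* q ℕ.+ D) F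
      ≡⟨ ∑<-+ (D ℕ.* q) D F ⟩
    ∑< (D ℕ.* q) F + ∑[ j < D ] F (D ℕ.* q ℕ.+ j)
      ≡⟨ cong₂ _+_ (∑<-multiples d q h) (∑<-single _ (ℕ.n<1+n d) others) ⟩
    ∑[ m < q ] h (D ℕ.* suc m) + F (D ℕ.* q ℕ.+ d)
      ≡⟨ cong (_+_ (∑[ m < q ] h (D ℕ.* suc m))) last ⟩
    ∑[ m < q ] h (D ℕ.* suc m) + h (D ℕ.* suc q)
      ≡⟨ sym (∑<-suc q (λ m → h (D ℕ.* suc m))) ⟩
    ∑[ m < suc q ] h (D ℕ.* suc m) ∎
    where
    open ≡-Reasoning
    D = suc d
    F : ℕ → ℤ
    F i = [ D ∣ suc i ] * h (suc i)
    next-multiple : suc (D ℕ.* q ℕ.+ d) ≡ D ℕ.* suc q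
    next-multiple = begin
      suc (D ℕ.* q ℕ.+ d)   ≡⟨ sym (ℕ.+-suc (D ℕ.* q) d) ⟩
      D ℕ.* q ℕ.+ D         ≡⟨ ℕ.+-comm (D ℕ.* q) D ⟩
      D ℕ.+ D ℕ.* q         ≡⟨ sym (ℕ.*-suc D q) ⟩
      D ℕ.* suc q           ∎
    last : F (D ℕ.* q ℕ.+ d) ≡ h (D ℕ.* suc q)
    last rewrite next-multiple | [∣]-yes {D} (m∣m*n (suc q)) = ℤ.*-identityˡ _
    between-multiples : ∀ {j} → j < D → j ≢ d → ¬ D ∣ suc (D ℕ.* q ℕ.+ j)
    between-multiples {j} j<D j≢d D∣ = ℕ.<⇒≱ (s≤s (ℕ.≤∧≢⇒< (ℕ.≤-pred j<D) j≢d))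
      (∣⇒≤ (∣m+n∣m⇒∣n (subst (D ∣_) (sym (ℕ.+-suc (D ℕ.* q) j)) D∣) (m∣m*n q)))
    others : ∀ j → j < D → j ≢ d → F (D ℕ.* q ℕ.+ j) ≡ + 0
    others j j<D j≢d rewrite [∣]-no (between-multiples j<D j≢d) = refl

  -- Division with junk value 0 at divisor 0; at a divisor d of n it is the
  -- n / d of divisorSum.
  infixl 7 _÷_

  _÷_ : ℕ → ℕ → ℕ
  n ÷ zero  = 0
  n ÷ suc d = n / suc d

  ∑∣-multiples : ∀ e t (G : ℕ → ℤ) →
    ∑[ n ∣ t ] ([ suc e ∣ n ] * G n) ≡ [ suc e ∣ t ] * ∑[ m ∣ t ÷ suc e ] G (suc e ℕ.* m)
  ∑∣-multiples e t G with suc e ∣? t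
  ... | no e∤t rewrite [∣]-no e∤t = ∑<-zero t vanish
    where
    vanish : ∀ i → i < t → [ suc i ∣ t ] * ([ suc e ∣ suc i ] * G (suc i)) ≡ + 0
    vanish i _ with suc i ∣? t
    ... | no  i∤t rewrite [∣]-no i∤t = refl
    ... | yes i∣t rewrite [∣]-yes i∣t | [∣]-no (λ e∣i → e∤t (∣-trans e∣i i∣t)) = refl
  ... | yes e∣t rewrite [∣]-yes e∣t = begin
    ∑[ i < t ] ([ suc i ∣ t ] * ([ E ∣ suc i ] * G (suc i)))
      ≡⟨ ∑<-cong t (λ i _ → x∙yz≈y∙xz [ suc i ∣ t ] [ E ∣ suc i ] (G (suc i))) ⟩
    ∑[ i < t ] ([ E ∣ suc i ] * G′ (suc i))
      ≡⟨ cong (λ k → ∑[ i < k ] ([ E ∣ suc i ] * G′ (suc i))) t≡E*q ⟩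
    ∑[ i < E ℕ.* q ] ([ E ∣ suc i ] * G′ (suc i))
      ≡⟨ ∑<-multiples e q G′ ⟩
    ∑[ m < q ] ([ E ℕ.* suc m ∣ t ] * G (E ℕ.* suc m))
      ≡⟨ ∑<-cong q (λ m _ → cong (_* G (E ℕ.* suc m)) (cancel m)) ⟩
    ∑[ m ∣ q ] G (E ℕ.* m)
      ≡⟨ sym (ℤ.*-identityˡ _) ⟩
    + 1 * ∑[ m ∣ q ] G (E ℕ.* m) ∎
    where
    open ≡-Reasoning
    E = suc e
    q = t / E
    G′ : ℕ → ℤ
    G′ n = [ n ∣ t ] * G n
    t≡E*q : t ≡ E ℕ.* q
    t≡E*q = trans (sym (m/n*n≡m e∣t)) (ℕ.*-comm q E)
    cancel : ∀ m → [ E ℕ.* suc m ∣ t ] ≡ [ suc m ∣ q ]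
    cancel m = trans (cong [ E ℕ.* suc m ∣_] t≡E*q) ([∣]-*-cancelˡ e (suc m) q)

  ∑∣-∑∣ : ∀ t (F : ℕ → ℕ → ℤ) →
    ∑[ n ∣ t ] ∑[ e ∣ n ] F n e ≡ ∑[ e ∣ t ] ∑[ m ∣ t ÷ e ] F (e ℕ.* m) e
  ∑∣-∑∣ t F = begin
    ∑[ i < t ] ([ suc i ∣ t ] * ∑[ e ∣ suc i ] F (suc i) e)
      ≡⟨ ∑<-cong t expand ⟩
    ∑[ i < t ] ∑[ j < t ] ([ suc i ∣ t ] * ([ suc j ∣ suc i ] * F (suc i) (suc j)))
      ≡⟨ ∑-comm (upTo t) (upTo t) _ ⟩
    ∑[ j < t ] ∑[ n ∣ t ] ([ suc j ∣ n ] * F n (suc j))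
      ≡⟨ ∑<-cong t (λ j _ → ∑∣-multiples j t (λ n → F n (suc j))) ⟩
    ∑[ e ∣ t ] ∑[ m ∣ t ÷ e ] F (e ℕ.* m) e ∎
    where
    open ≡-Reasoning
    expand : ∀ i → i < t →
      [ suc i ∣ t ] * ∑[ e ∣ suc i ] F (suc i) e
        ≡ ∑[ j < t ] ([ suc i ∣ t ] * ([ suc j ∣ suc i ] * F (suc i) (suc j)))
    expand i i<t = trans (cong ([ suc i ∣ t ] *_) (sym (∑∣-range (F (suc i)) (s≤s z≤n) i<t)))
                         (*-distribˡ-∑ [ suc i ∣ t ] (upTo t) _)

  ∑∣-∑-comm : ∀ n xs (f : ℕ → A → ℤ) →
    ∑[ d ∣ n ] ∑[ x ∈ xs ] f d x ≡ ∑[ x ∈ xs ] ∑[ d ∣ n ] f d x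
  ∑∣-∑-comm n xs f =
    trans (∑<-cong n (λ i _ → *-distribˡ-∑ [ suc i ∣ n ] xs (f (suc i)))) (∑-comm (upTo n) xs _)

module Möbius where
  open import Data.Integer using (_+_; _*_; -_)
  open FiniteSums
  open DivisorSums

  ∤-prime⇒coprime : ∀ {p d} → Prime p → ¬ p ∣ d → Coprime d p
  ∤-prime⇒coprime p-prime p∤d (i∣d , i∣p) with prime⇒irreducible p-prime i∣p
  ... | inj₁ i≡1 = i≡1
  ... | inj₂ refl = ⊥-elim (p∤d i∣d)

  ∣-*-prime : ∀ {p d k} → Prime p → ¬ p ∣ d → d ∣ p ℕ.* k → d ∣ k
  ∣-*-prime p-prime p∤d = coprime-divisor (∤-prime⇒coprime p-prime p∤d)

  [∣]-*-prime : ∀ {p d k} → Prime p → ¬ p ∣ d → [ d ∣ p ℕ.* k ] ≡ [ d ∣ k ]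
  [∣]-*-prime {p} {d} {k} p-prime p∤d with d ∣? k
  ... | yes d∣k = [∣]-yes (∣-trans d∣k (n∣m*n p))
  ... | no  d∤k = [∣]-no (λ d∣pk → d∤k (∣-*-prime p-prime p∤d d∣pk))

  prime-∤-prime : ∀ {p q} → Prime p → Prime q → q ≢ p → ¬ p ∣ q
  prime-∤-prime p-prime q-prime q≢p p∣q with prime⇒irreducible q-prime p∣q
  ... | inj₁ refl = ¬prime[1] p-prime
  ... | inj₂ p≡q  = q≢p (sym p≡q)

  prime-factor : ∀ n → ∃ λ p → ∃ λ k → Prime p × 2 ℕ.+ n ≡ p ℕ.* k
  prime-factor n with factorise (2 ℕ.+ n)
  ... | record { factors = [] ; isFactorisation = () }
  ... | record { factors = p ∷ ps ; isFactorisation = n≡ ; factorsPrime = p-prime ∷ _ } =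
    p , _ , p-prime , n≡

  T-does⇒ : ∀ {P : Set} (P? : Dec P) → T (does P?) → P
  T-does⇒ (yes p) _  = p
  T-does⇒ (no _)  ()

  squareFreeᵇ-false : ∀ {n} .{{_ : NonZero n}} i →
    suc (suc i) ℕ.* suc (suc i) ∣ n → squareFreeᵇ n ≡ false
  squareFreeᵇ-false {n} i sq∣n =
    cong not (Equivalence.to T-≡ (any⁺ _ (lose (∈-upTo⁺ i<n) T[sq∣?n])))
    where
    T[sq∣?n] : T (does (suc (suc i) ℕ.* suc (suc i) ∣? n))
    T[sq∣?n] = Equivalence.from T-≡ (dec-true (_ ∣? n) sq∣n)
    i<n : i < n
    i<n = ℕ.<-≤-trans (ℕ.<-≤-trans (ℕ.n<1+n i) (ℕ.n≤1+n (suc i)))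
                      (ℕ.≤-trans (ℕ.m≤m*n (suc (suc i)) (suc (suc i))) (∣⇒≤ sq∣n))

  squareFreeᵇ-false⁻¹ : ∀ {n} → squareFreeᵇ n ≡ false → ∃ λ i → suc (suc i) ℕ.* suc (suc i) ∣ n
  squareFreeᵇ-false⁻¹ {n} sf≡false =
    let i , T-sq∣n = satisfied (any⁻ _ (upTo n) (Equivalence.from T-≡ (not-injective sf≡false)))
    in i , T-does⇒ (_ ∣? n) T-sq∣n

  square∣-*-prime : ∀ {p m q} → Prime p → ¬ p ∣ m → q ℕ.* q ∣ p ℕ.* m → q ℕ.* q ∣ m
  square∣-*-prime {p} {m} {q} p-prime p∤m qq∣pm with p ∣? q
  ... | yes p∣q =
    ⊥-elim (p∤m (*-cancelˡ-∣ p {{prime⇒nonZero p-prime}} (∣-trans (*-pres-∣ p∣q p∣q) qq∣pm)))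
  ... | no  p∤q = ∣-*-prime p-prime (λ p∣qq → [ p∤q , p∤q ]′ (euclidsLemma q q p-prime p∣qq)) qq∣pm

  squareFreeᵇ-*-prime : ∀ {p m} .{{_ : NonZero m}} → Prime p → ¬ p ∣ m →
    squareFreeᵇ (p ℕ.* m) ≡ squareFreeᵇ m
  squareFreeᵇ-*-prime {p} {m} p-prime p∤m with squareFreeᵇ m in sf[m]
  ... | false = let i , sq∣m = squareFreeᵇ-false⁻¹ {m} sf[m] in
    squareFreeᵇ-false {{ℕ.m*n≢0 p m {{prime⇒nonZero p-prime}}}} i (∣-trans sq∣m (n∣m*n p))
  ... | true with squareFreeᵇ (p ℕ.* m) in sf[pm]
  ...   | true  = refl
  ...   | false = let i , sq∣pm = squareFreeᵇ-false⁻¹ {p ℕ.* m} sf[pm] in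
    contradiction (trans (sym sf[m]) (squareFreeᵇ-false i (square∣-*-prime {p} {m} {suc (suc i)} p-prime p∤m sq∣pm)))
      λ ()

  primeDivisorᵇ : ℕ → ℕ → Bool
  primeDivisorᵇ n q = does (prime? q) ∧ does (q ∣? n)

  +ω≡∑ : ∀ n → + ω n ≡ ∑[ q < suc n ] 𝟙 (primeDivisorᵇ n q)
  +ω≡∑ n = +-length-filterᵇ (primeDivisorᵇ n) (upTo (suc n))

  primeDivisorᵇ-*-prime : ∀ {p m} q → Prime p → ¬ p ∣ m →
    𝟙 (primeDivisorᵇ (p ℕ.* m) q) ≡ 𝟙 (does (q ℕ.≟ p)) + 𝟙 (primeDivisorᵇ m q)
  primeDivisorᵇ-*-prime {p} {m} q p-prime p∤m with prime? q
  ... | no ¬q-prime =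
    sym (cong (λ x → x + + 0) (𝟙-no (q ℕ.≟ p) (λ q≡p → ¬q-prime (subst Prime (sym q≡p) p-prime))))
  ... | yes q-prime with q ℕ.≟ p
  ...   | yes refl = trans ([∣]-yes {p} (m∣m*n m)) (sym (cong₂ _+_ (𝟙-yes (p ℕ.≟ p) refl) ([∣]-no p∤m)))
  ...   | no  q≢p  = trans ([∣]-*-prime p-prime (prime-∤-prime p-prime q-prime q≢p))
                           (sym (trans (cong (λ x → x + [ q ∣ m ]) (𝟙-no (q ℕ.≟ p) q≢p)) (ℤ.+-identityˡ _)))

  ω-*-prime : ∀ {p m} .{{_ : NonZero m}} → Prime p → ¬ p ∣ m → ω (p ℕ.* m) ≡ suc (ω m)
  ω-*-prime {p} {m} p-prime p∤m = ℤ.+-injective (begin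
    + ω (p ℕ.* m)
      ≡⟨ +ω≡∑ (p ℕ.* m) ⟩
    ∑[ q < suc (p ℕ.* m) ] 𝟙 (primeDivisorᵇ (p ℕ.* m) q)
      ≡⟨ ∑<-cong (suc (p ℕ.* m)) (λ q _ → primeDivisorᵇ-*-prime q p-prime p∤m) ⟩
    ∑[ q < suc (p ℕ.* m) ] (𝟙 (does (q ℕ.≟ p)) + 𝟙 (primeDivisorᵇ m q))
      ≡⟨ ∑-distrib-+ (upTo (suc (p ℕ.* m))) (λ q → 𝟙 (does (q ℕ.≟ p))) (λ q → 𝟙 (primeDivisorᵇ m q)) ⟩
    ∑[ q < suc (p ℕ.* m) ] 𝟙 (does (q ℕ.≟ p)) + ∑[ q < suc (p ℕ.* m) ] 𝟙 (primeDivisorᵇ m q)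
      ≡⟨ cong₂ _+_ only-p no-large-divisors ⟩
    + 1 + ∑[ q < suc m ] 𝟙 (primeDivisorᵇ m q)
      ≡⟨ cong (_+_ (+ 1)) (sym (+ω≡∑ m)) ⟩
    + suc (ω m) ∎)
    where
    open ≡-Reasoning
    instance _ = prime⇒nonZero p-prime
    only-p : ∑[ q < suc (p ℕ.* m) ] 𝟙 (does (q ℕ.≟ p)) ≡ + 1
    only-p = trans (∑<-single (λ q → 𝟙 (does (q ℕ.≟ p))) (s≤s (ℕ.m≤m*n p m)) (λ q _ q≢p → 𝟙-no (q ℕ.≟ p) q≢p))
                   (𝟙-yes (p ℕ.≟ p) refl)
    no-large-divisors :
      ∑[ q < suc (p ℕ.* m) ] 𝟙 (primeDivisorᵇ m q) ≡ ∑[ q < suc m ] 𝟙 (primeDivisorᵇ m q)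
    no-large-divisors = ∑<-extend (λ q → 𝟙 (primeDivisorᵇ m q)) (s≤s (ℕ.m≤n*m m p)) λ q m<q _ → begin
      𝟙 (primeDivisorᵇ m q)
        ≡⟨ 𝟙-∧ (does (prime? q)) _ ⟩
      𝟙 (does (prime? q)) * [ q ∣ m ]
        ≡⟨ cong (𝟙 (does (prime? q)) *_) ([∣]-no {q} {m} (λ q∣m → ℕ.<⇒≱ m<q (∣⇒≤ q∣m))) ⟩
      𝟙 (does (prime? q)) * + 0
        ≡⟨ ℤ.*-zeroʳ (𝟙 (does (prime? q))) ⟩
      + 0 ∎

  μ-*-prime-∣ : ∀ {p m} .{{_ : NonZero m}} → Prime p → p ∣ m → μ (p ℕ.* m) ≡ + 0
  μ-*-prime-∣ {p@(suc (suc i))} {m} _ p∣m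
    rewrite squareFreeᵇ-false {p ℕ.* m} {{ℕ.m*n≢0 p m}} i (*-monoʳ-∣ p p∣m) = refl

  μ-*-prime-∤ : ∀ {p m} .{{_ : NonZero m}} → Prime p → ¬ p ∣ m → μ (p ℕ.* m) ≡ - μ m
  μ-*-prime-∤ {p} {m} p-prime p∤m
    rewrite squareFreeᵇ-*-prime p-prime p∤m | ω-*-prime p-prime p∤m with squareFreeᵇ m
  ... | true  = ℤ.-1*i≡-i _
  ... | false = refl

  μ-*-prime : ∀ {p m} .{{_ : NonZero m}} → Prime p → μ (p ℕ.* m) ≡ - ([ p ∤ m ] * μ m)
  μ-*-prime {p} {m} p-prime with p ∣? m
  ... | yes p∣m = μ-*-prime-∣ p-prime p∣m
  ... | no  p∤m = trans (μ-*-prime-∤ p-prime p∤m) (cong -_ (sym (ℤ.*-identityˡ (μ m))))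

  δ : ℕ → ℤ
  δ n = 𝟙 (does (n ℕ.≟ 1))

  ∑∣-μ-*-prime : ∀ {p k} .{{_ : NonZero k}} → Prime p → ∑∣ (p ℕ.* k) μ ≡ + 0
  ∑∣-μ-*-prime {zero} ()
  ∑∣-μ-*-prime {p@(suc p-1)} {k} p-prime = begin
    ∑∣ n μ
      ≡⟨ ∑∣-cong n {μ} {λ d → [ p ∤ d ] * μ d + [ p ∣ d ] * μ d} (λ d → split (does (p ∣? suc d)) _) ⟩
    ∑[ d ∣ n ] ([ p ∤ d ] * μ d + [ p ∣ d ] * μ d)
      ≡⟨ ∑∣-distrib-+ n (λ d → [ p ∤ d ] * μ d) (λ d → [ p ∣ d ] * μ d) ⟩
    ∑[ d ∣ n ] ([ p ∤ d ] * μ d) + ∑[ d ∣ n ] ([ p ∣ d ] * μ d)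
      ≡⟨ cong₂ _+_ coprime-part multiple-part ⟩
    S + - S
      ≡⟨ ℤ.+-inverseʳ S ⟩
    + 0 ∎
    where
    open ≡-Reasoning
    n = p ℕ.* k
    S = ∑[ d ∣ k ] ([ p ∤ d ] * μ d)
    split : ∀ b x → x ≡ 𝟙 (not b) * x + 𝟙 b * x
    split true  x = sym (trans (ℤ.+-identityˡ _) (ℤ.*-identityˡ x))
    split false x = sym (trans (ℤ.+-identityʳ _) (ℤ.*-identityˡ x))
    restrict : ∀ d → [ d ∣ n ] * ([ p ∤ d ] * μ d) ≡ [ d ∣ k ] * ([ p ∤ d ] * μ d)
    restrict d with p ∣? d
    ... | yes p∣d rewrite [∤]-no p∣d = trans (ℤ.*-zeroʳ [ d ∣ n ]) (sym (ℤ.*-zeroʳ [ d ∣ k ]))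
    ... | no  p∤d rewrite [∤]-yes p∤d | [∣]-*-prime {k = k} p-prime p∤d = refl
    coprime-part : ∑[ d ∣ n ] ([ p ∤ d ] * μ d) ≡ S
    coprime-part = trans (∑<-cong n (λ i _ → restrict (suc i)))
                         (∑∣-range (λ d → [ p ∤ d ] * μ d) (ℕ.>-nonZero⁻¹ k) (ℕ.m≤n*m k p))
    multiple-part : ∑[ d ∣ n ] ([ p ∣ d ] * μ d) ≡ - S
    multiple-part = begin
      ∑[ d ∣ n ] ([ p ∣ d ] * μ d)
        ≡⟨ ∑∣-multiples p-1 n μ ⟩
      [ p ∣ n ] * ∑[ m ∣ n ÷ p ] μ (p ℕ.* m)
        ≡⟨ cong₂ (λ x m → x * ∑[ d ∣ m ] μ (p ℕ.* d)) ([∣]-yes {p} (m∣m*n k)) n÷p≡k ⟩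
      + 1 * ∑[ m ∣ k ] μ (p ℕ.* m)
        ≡⟨ ℤ.*-identityˡ _ ⟩
      ∑[ m ∣ k ] μ (p ℕ.* m)
        ≡⟨ ∑∣-cong k {λ m → μ (p ℕ.* m)} {λ m → - ([ p ∤ m ] * μ m)} (λ m → μ-*-prime {p} {suc m} p-prime) ⟩
      ∑[ m ∣ k ] (- ([ p ∤ m ] * μ m))
        ≡⟨ sym (neg-distrib-∑∣ k (λ m → [ p ∤ m ] * μ m)) ⟩
      - S ∎
      where
      n÷p≡k : n ÷ p ≡ k
      n÷p≡k = trans (cong (_/ p) (ℕ.*-comm p k)) (m*n/n≡m k p)

  ∑∣-μ : ∀ n → ∑∣ n μ ≡ δ n
  ∑∣-μ 0 = refl
  ∑∣-μ 1 = refl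
  ∑∣-μ (suc (suc n)) with prime-factor n
  ... | p , k , p-prime , 2+n≡p*k =
    trans (cong (λ m → ∑∣ m μ) 2+n≡p*k)
          (∑∣-μ-*-prime {{ℕ.m*n≢0⇒n≢0 p {{subst NonZero 2+n≡p*k _}}}} p-prime)

  δ-≢1 : ∀ {n} → n ≢ 1 → δ n ≡ + 0
  δ-≢1 {n} n≢1 = 𝟙-no (n ℕ.≟ 1) n≢1

  ∑∣-δ : ∀ t .{{_ : NonZero t}} (g : ℕ → ℤ) → ∑[ e ∣ t ] (g e * δ (t ÷ e)) ≡ g t
  ∑∣-δ t@(suc t-1) g = trans (∑<-single _ (ℕ.n<1+n t-1) others) last
    where
    last : [ t ∣ t ] * (g t * δ (t ÷ t)) ≡ g t
    last rewrite [∣]-yes (∣-refl {t}) | n/n≡1 t {{_}} = trans (ℤ.*-identityˡ _) (ℤ.*-identityʳ (g t))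
    proper-quotient≢1 : ∀ {i} → suc i ∣ t → i ≢ t-1 → t / suc i ≢ 1
    proper-quotient≢1 {i} i+1∣t i≢t-1 t/[i+1]≡1 = i≢t-1 (ℕ.suc-injective (begin
      suc i                    ≡⟨ sym (ℕ.*-identityˡ (suc i)) ⟩
      1 ℕ.* suc i              ≡⟨ cong (ℕ._* suc i) (sym t/[i+1]≡1) ⟩
      t / suc i ℕ.* suc i      ≡⟨ m/n*n≡m i+1∣t ⟩
      t                        ∎))
      where open ≡-Reasoning
    others : ∀ i → i < t → i ≢ t-1 → [ suc i ∣ t ] * (g (suc i) * δ (t ÷ suc i)) ≡ + 0
    others i _ i≢t-1 with suc i ∣? t
    ... | no  i+1∤t rewrite [∣]-no i+1∤t = refl
    ... | yes i+1∣t rewrite [∣]-yes i+1∣t | δ-≢1 (proper-quotient≢1 i+1∣t i≢t-1) =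
      trans (ℤ.*-identityˡ _) (ℤ.*-zeroʳ (g (suc i)))

  möbius-inversion : ∀ t .{{_ : NonZero t}} (g : ℕ → ℤ) →
    ∑[ n ∣ t ] ∑[ e ∣ n ] (μ (n ÷ e) * g e) ≡ g t
  möbius-inversion t g = begin
    ∑[ n ∣ t ] ∑[ e ∣ n ] (μ (n ÷ e) * g e)
      ≡⟨ ∑∣-∑∣ t (λ n e → μ (n ÷ e) * g e) ⟩
    ∑[ e ∣ t ] ∑[ m ∣ t ÷ e ] (μ (e ℕ.* m ÷ e) * g e)
      ≡⟨ ∑∣-cong t {λ e → ∑[ m ∣ t ÷ e ] (μ (e ℕ.* m ÷ e) * g e)} {λ e → g e * δ (t ÷ e)} inner ⟩
    ∑[ e ∣ t ] (g e * δ (t ÷ e))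
      ≡⟨ ∑∣-δ t g ⟩
    g t ∎
    where
    open ≡-Reasoning
    inner : ∀ e → ∑[ m ∣ t ÷ suc e ] (μ (suc e ℕ.* m ÷ suc e) * g (suc e)) ≡ g (suc e) * δ (t ÷ suc e)
    inner e = begin
      ∑[ m ∣ q ] (μ (E ℕ.* m ÷ E) * g E)
        ≡⟨ ∑∣-cong q {λ m → μ (E ℕ.* m ÷ E) * g E} {λ m → g E * μ m} cancel-E ⟩
      ∑[ m ∣ q ] (g E * μ m)
        ≡⟨ sym (*-distribˡ-∑∣ (g E) q μ) ⟩
      g E * ∑∣ q μ
        ≡⟨ cong (g E *_) (∑∣-μ q) ⟩
      g E * δ q ∎
      where
      E = suc e
      q = t ÷ E
      cancel-E : ∀ m → μ (E ℕ.* suc m ÷ E) * g E ≡ g E * μ (suc m)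
      cancel-E m = trans (cong (λ x → μ x * g E) (trans (cong (_/ E) (ℕ.*-comm E (suc m))) (m*n/n≡m (suc m) E)))
                         (ℤ.*-comm (μ (suc m)) (g E))

  möbius-inversion-below : ∀ {t K} .{{_ : NonZero t}} → t ≤ K → (g : ℕ → ℤ) →
    ∑[ i < K ] ∑[ e ∣ suc i ] (μ (suc i ÷ e) * ([ suc i ∣ t ] * g e)) ≡ g t
  möbius-inversion-below {t} {K} t≤K g = begin
    ∑[ i < K ] ∑[ e ∣ suc i ] (μ (suc i ÷ e) * ([ suc i ∣ t ] * g e))
      ≡⟨ ∑<-cong K (λ i _ → factor-out (suc i)) ⟩
    ∑[ i < K ] ([ suc i ∣ t ] * ∑[ e ∣ suc i ] (μ (suc i ÷ e) * g e))
      ≡⟨ ∑∣-range (λ n → ∑[ e ∣ n ] (μ (n ÷ e) * g e)) (ℕ.>-nonZero⁻¹ t) t≤K ⟩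
    ∑[ n ∣ t ] ∑[ e ∣ n ] (μ (n ÷ e) * g e)
      ≡⟨ möbius-inversion t g ⟩
    g t ∎
    where
    open ≡-Reasoning
    factor-out : ∀ n →
      ∑[ e ∣ n ] (μ (n ÷ e) * ([ n ∣ t ] * g e)) ≡ [ n ∣ t ] * ∑[ e ∣ n ] (μ (n ÷ e) * g e)
    factor-out n = trans (∑∣-cong n {λ e → μ (n ÷ e) * ([ n ∣ t ] * g e)} {λ e → [ n ∣ t ] * (μ (n ÷ e) * g e)}
                                    (λ e → x∙yz≈y∙xz (μ (n ÷ suc e)) [ n ∣ t ] (g (suc e))))
                         (sym (*-distribˡ-∑∣ [ n ∣ t ] n (λ e → μ (n ÷ e) * g e)))

  möbius-inversion-∑ : ∀ {A : Set} K (xs : List A) (t : A → ℕ) (g : A → ℕ → ℤ) (c : ℕ → ℕ → ℤ) →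
    (∀ x → x ∈ xs → 0 < t x × t x ≤ K) →
    (∀ e n → c e n ≡ ∑[ x ∈ xs ] ([ n ∣ t x ] * g x e)) →
    ∑[ i < K ] ∑[ e ∣ suc i ] (μ (suc i ÷ e) * c e (suc i)) ≡ ∑[ x ∈ xs ] g x (t x)
  möbius-inversion-∑ K xs t g c t-bounds c≡∑ = begin
    ∑[ i < K ] ∑[ e ∣ suc i ] (μ (suc i ÷ e) * c e (suc i))
      ≡⟨ ∑<-cong K (λ i _ → expand (suc i)) ⟩
    ∑[ i < K ] ∑[ x ∈ xs ] ∑[ e ∣ suc i ] (μ (suc i ÷ e) * ([ suc i ∣ t x ] * g x e))
      ≡⟨ ∑-comm (upTo K) xs _ ⟩
    ∑[ x ∈ xs ] ∑[ i < K ] ∑[ e ∣ suc i ] (μ (suc i ÷ e) * ([ suc i ∣ t x ] * g x e))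
      ≡⟨ ∑-cong xs invert ⟩
    ∑[ x ∈ xs ] g x (t x) ∎
    where
    open ≡-Reasoning
    expand : ∀ n →
      ∑[ e ∣ n ] (μ (n ÷ e) * c e n) ≡ ∑[ x ∈ xs ] ∑[ e ∣ n ] (μ (n ÷ e) * ([ n ∣ t x ] * g x e))
    expand n = trans (∑∣-cong n {λ e → μ (n ÷ e) * c e n} {λ e → ∑[ x ∈ xs ] (μ (n ÷ e) * ([ n ∣ t x ] * g x e))}
                                (λ e → trans (cong (μ (n ÷ suc e) *_) (c≡∑ (suc e) n)) (*-distribˡ-∑ (μ (n ÷ suc e)) xs _)))
                     (∑∣-∑-comm n xs (λ e x → μ (n ÷ e) * ([ n ∣ t x ] * g x e)))
    invert : ∀ x → x ∈ xs →
      ∑[ i < K ] ∑[ e ∣ suc i ] (μ (suc i ÷ e) * ([ suc i ∣ t x ] * g x e)) ≡ g x (t x)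
    invert x x∈xs = let 0<t , t≤K = t-bounds x x∈xs in
      möbius-inversion-below {{ℕ.>-nonZero 0<t}} t≤K (g x)

  divisorSum-∑∣ : ∀ M n → divisorSum M n ≡ ∑[ e ∣ n ] (μ (n ÷ e) * + M e)
  divisorSum-∑∣ M n = ∑<-cong n (λ i _ → if-then-0 (does (suc i ∣? n)) _)

open FiniteSums
open DivisorSums
open Möbius

IsTmd-positive : ∀ E {d} → IsTmd E d → 0 < d
IsTmd-positive (A , B) (0<d , _) = 0<d

IsTmd-unique : ∀ E {d d′} → IsTmd E d → IsTmd E d′ → d ≡ d′
IsTmd-unique (A , B) (0<d , d²∣A , d³∣B , d-max) (0<d′ , d′²∣A , d′³∣B , d′-max) =
  ℕ.≤-antisym (d′-max _ 0<d d²∣A d³∣B) (d-max _ 0<d′ d′²∣A d′³∣B)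

natℚ-mono-≤ : ∀ {m n} → m ≤ n → natℚ m ℚ.≤ natℚ n
natℚ-mono-≤ {m} {n} m≤n
  rewrite ℚ.normalize-coprime {m} {0} (Coprime.sym (Coprime.1-coprimeTo m))
        | ℚ.normalize-coprime {n} {0} (Coprime.sym (Coprime.1-coprimeTo n))
  = ℚ.*≤* (ℤ.*-monoʳ-≤-nonNeg (+ 1) (ℤ.+≤+ m≤n))

≤-sum : ∀ {A : Set} (f : A → ℕ) {x xs} → x ∈ xs → f x ≤ sum (map f xs)
≤-sum f {xs = y ∷ ys} (here refl) = ℕ.m≤m+n (f y) _
≤-sum f {xs = y ∷ ys} (there x∈ys) = ℕ.≤-trans (≤-sum f x∈ys) (ℕ.m≤n+m _ (f y))

module Counting (mult : Model → ℕ) (X : ℚ) (0<X : 0ℚ ℚ.< X) (L : List Model) (L-unique : Unique L)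
  (L-spec : ∀ E → (E ∈ L → mult E ≢ 0 × TwhtLe X E) × (mult E ≢ 0 × TwhtLe X E → E ∈ L)) where
  open import Data.Integer using (_*_)

  open DecMembership (≡-dec ℤ._≟_ ℤ._≟_) using (_∈?_)

  instance
    X≥0 : ℚ.NonNegative X
    X≥0 = ℚ.nonNegative (ℚ.<⇒≤ 0<X)

  TmdWitness : Model → ℕ → Set
  TmdWitness E d = IsTmd E d × natℚ (H E) ℚ.≤ natℚ (d ^ 6) ℚ.* X

  -- The defect of a member of L is read off the witness of its twist height;
  -- outside L the value 0 is junk.
  tmdOf′ : ∀ E → Dec (E ∈ L) → ℕ
  tmdOf′ E (yes E∈L) = proj₁ (proj₂ (proj₁ (L-spec E) E∈L))
  tmdOf′ E (no  _)   = 0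

  tmdOf : Model → ℕ
  tmdOf E = tmdOf′ E (E ∈? L)

  tmdOf′-spec : ∀ {E} (E∈L? : Dec (E ∈ L)) → E ∈ L → TmdWitness E (tmdOf′ E E∈L?)
  tmdOf′-spec {E} (yes E∈L) _   = proj₂ (proj₂ (proj₁ (L-spec E) E∈L))
  tmdOf′-spec     (no  E∉L) E∈L = ⊥-elim (E∉L E∈L)

  tmdOf-spec : ∀ {E} → E ∈ L → TmdWitness E (tmdOf E)
  tmdOf-spec {E} = tmdOf′-spec (E ∈? L)

  height≤? : ∀ e E → Dec (natℚ (H E) ℚ.≤ natℚ (e ^ 6) ℚ.* X)
  height≤? e E = natℚ (H E) ℚ.≤? natℚ (e ^ 6) ℚ.* X

  counted? : ∀ e n E → Dec (natℚ (H E) ℚ.≤ natℚ (e ^ 6) ℚ.* X × n ∣ tmdOf E)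
  counted? e n E = height≤? e E ×-dec (n ∣? tmdOf E)

  M : ℕ → ℕ → ℕ
  M e n = sum (map mult (filter (counted? e n) L))

  M-count : ∀ n e → 0 < n → e ∣ n → CountIs mult (MCond (natℚ (e ^ 6) ℚ.* X) n) (M e n)
  M-count n e _ e∣n =
    filter (counted? e n) L , Unique.filter⁺ (counted? e n) L-unique , (λ E → sound E , complete E) , refl
    where
    sound : ∀ E → E ∈ filter (counted? e n) L → mult E ≢ 0 × MCond (natℚ (e ^ 6) ℚ.* X) n E
    sound E E∈ = let E∈L , H≤ , n∣t = ∈-filter⁻ (counted? e n) E∈ in
      proj₁ (proj₁ (L-spec E) E∈L) , H≤ , tmdOf E , proj₁ (tmdOf-spec E∈L) , n∣t
    complete : ∀ E → mult E ≢ 0 × MCond (natℚ (e ^ 6) ℚ.* X) n E → E ∈ filter (counted? e n) L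
    complete E (mult≢0 , H≤ , d , d-tmd , n∣d) =
      ∈-filter⁺ (counted? e n) E∈L (H≤ , subst (n ∣_) (IsTmd-unique E d-tmd (proj₁ (tmdOf-spec E∈L))) n∣d)
      where
      instance _ = ℕ.>-nonZero (IsTmd-positive E d-tmd)
      H≤d⁶X : natℚ (H E) ℚ.≤ natℚ (d ^ 6) ℚ.* X
      H≤d⁶X = ℚ.≤-trans H≤
        (ℚ.*-monoʳ-≤-nonNeg X (natℚ-mono-≤ (ℕ.^-monoˡ-≤ 6 (∣⇒≤ (∣-trans e∣n n∣d)))))
      E∈L : E ∈ L
      E∈L = proj₂ (L-spec E) (mult≢0 , d , d-tmd , H≤d⁶X)

  K : ℕ
  K = sum (map tmdOf L)

  tmdOf-bounds : ∀ E → E ∈ L → 0 < tmdOf E × tmdOf E ≤ K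
  tmdOf-bounds E E∈L = IsTmd-positive E (proj₁ (tmdOf-spec E∈L)) , ≤-sum tmdOf E∈L

  M-vanishes : ∀ e n → K < n → M e n ≡ 0
  M-vanishes e n K<n =
    cong (sum ∘ map mult) (List.filter-none (counted? e n) (All.tabulate (λ {E} E∈L → n∤tmd E E∈L ∘ proj₂)))
    where
    n∤tmd : ∀ E → E ∈ L → ¬ n ∣ tmdOf E
    n∤tmd E E∈L n∣t = let 0<t , t≤K = tmdOf-bounds E E∈L in
      ℕ.<⇒≱ (ℕ.≤-<-trans t≤K K<n) (∣⇒≤ {{ℕ.>-nonZero 0<t}} n∣t)

  divisorSum-vanishes : ∀ n → K < n → divisorSum (λ e → M e n) n ≡ + 0
  divisorSum-vanishes n K<n = trans (divisorSum-∑∣ (λ e → M e n) n)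
    (∑∣-zero n {λ e → μ (n ÷ e) * + M e n} λ e →
      trans (cong (λ m → μ (n ÷ suc e) * + m) (M-vanishes (suc e) n K<n)) (ℤ.*-zeroʳ (μ (n ÷ suc e))))

  weight : Model → ℕ → ℤ
  weight E e = + mult E * 𝟙 (does (height≤? e E))

  +M≡∑ : ∀ e n → + M e n ≡ ∑[ E ∈ L ] ([ n ∣ tmdOf E ] * weight E e)
  +M≡∑ e n = trans (+-sum-filter mult (counted? e n) L) (∑-cong L (λ E _ → rearrange E))
    where
    rearrange : ∀ E → + mult E * 𝟙 (does (counted? e n E)) ≡ [ n ∣ tmdOf E ] * weight E e
    rearrange E = trans (cong (+ mult E *_) (𝟙-∧ (does (height≤? e E)) _))
                        (x∙yz≈z∙xy (+ mult E) (𝟙 (does (height≤? e E))) [ n ∣ tmdOf E ])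

  weight-at-tmd : ∀ E → E ∈ L → weight E (tmdOf E) ≡ + mult E
  weight-at-tmd E E∈L = trans (cong (+ mult E *_) (𝟙-yes (height≤? (tmdOf E) E) (proj₂ (tmdOf-spec E∈L))))
                               (ℤ.*-identityʳ (+ mult E))

  count-by-tmd : ∀ {N} → sum (map mult L) ≡ N → + N ≡ sumTo (λ n → divisorSum (λ e → M e n) n) K
  count-by-tmd {N} ∑mult≡N = begin
    + N
      ≡⟨ cong +_ (sym ∑mult≡N) ⟩
    + sum (map mult L)
      ≡⟨ +-sum mult L ⟩
    ∑[ E ∈ L ] (+ mult E)
      ≡⟨ ∑-cong L (λ E E∈L → sym (weight-at-tmd E E∈L)) ⟩
    ∑[ E ∈ L ] weight E (tmdOf E)
      ≡⟨ sym (möbius-inversion-∑ K L tmdOf weight (λ e n → + M e n) tmdOf-bounds +M≡∑) ⟩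
    ∑[ i < K ] ∑[ e ∣ suc i ] (μ (suc i ÷ e) * + M e (suc i))
      ≡⟨ ∑<-cong K (λ i _ → sym (divisorSum-∑∣ (λ e → M e (suc i)) (suc i))) ⟩
    sumTo (λ n → divisorSum (λ e → M e n) n) K ∎
    where open ≡-Reasoning

open import Data.Rational using (_*_)

lemma3p5p1 : (mult : Model → ℕ) →
    (∀ E → mult E ≢ 0 → disc E ≢ + 0) →
    (∀ X → Data.Rational._<_ 0ℚ X → ∃ λ N → CountIs mult (TwhtLe X) N) →
    ∀ X → Data.Rational._<_ 0ℚ X → ∀ N → CountIs mult (TwhtLe X) N →
    Σ (ℕ → ℕ → ℕ) λ M →
      (∀ n e → 0 < n → e ∣ n → CountIs mult (MCond (natℚ (e ^ 6) * X) n) (M e n)) ×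
      (∃ λ K → (∀ n → K < n → divisorSum (λ e → M e n) n ≡ + 0) ×
               (+ N ≡ sumTo (λ n → divisorSum (λ e → M e n) n) K))
lemma3p5p1 mult _ _ X 0<X N (L , L-unique , L-spec , ∑mult≡N) =
  M , M-count , K , divisorSum-vanishes , count-by-tmd ∑mult≡N
  where open Counting mult X 0<X L L-unique L-spec
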